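{- Let $n \geq 2$ and let $K \subset \mathbf{R}^n$ be an empty lattice simplex. Then for every $x \in nK \cap \mathbf{Z}^n$ there exists $z \in K \cap \mathbf{Z}^n$ such that $x - z \in (n-1)K$. Equivalently, $nK \cap \mathbf{Z}^n = \big((n-1)K \cap \mathbf{Z}^n\big) + \big(K \cap \mathbf{Z}^n\big)$.
   Context: A lattice polytope in $\mathbf{R}^n$ is the convex hull of a finite subset of $\mathbf{Z}^n$; a lattice simplex is a lattice polytope that is a simplex. A lattice polytope $K$ is empty if $K \cap \mathbf{Z}^n$ consists only of the extreme points of $K$. For subsets $A,B$ of an abelian group, $A+B=\{a+b : a\in A, b\in B\}$. For a positive integer $k$ and a convex set $K$, $kK$ denotes $\{kx : x \in K\}$, which coincides with the $k$-fold sum $K+\cdots+K$. -}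

module Defs where

open import Data.Nat using (ℕ; zero; suc)
open import Data.Integer using (ℤ; +_)
open import Data.Fin using (Fin; zero; suc)
open import Data.Rational using (ℚ; 0ℚ; _+_; _*_; _≤_; _/_)
open import Data.Product using (Σ; ∃; _×_)
open import Relation.Binary.PropositionalEquality using (_≡_)

Point : ℕ → Set
Point n = Fin n → ℤ

ι : ℤ → ℚ
ι z = z / 1

Σℚ : ∀ {k} → (Fin k → ℚ) → ℚ
Σℚ {zero}  f = 0ℚ
Σℚ {suc k} f = f zero + Σℚ (λ i → f (suc i))

-- x = Σ λᵢ vᵢ with λᵢ ≥ 0 and Σ λᵢ = m, i.e. x ∈ m · conv(v₀,…,v_d).
-- (Coefficients rational: for integer x and affinely independent integer
-- vertices the barycentric coordinates are automatically rational.)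
InScaled : ∀ {n d} → ℕ → (Fin (suc d) → Point n) → Point n → Set
InScaled {n} {d} m v x =
  Σ (Fin (suc d) → ℚ) λ c →
    (∀ i → 0ℚ ≤ c i) ×
    (Σℚ c ≡ (+ m) / 1) ×
    (∀ (j : Fin n) → Σℚ (λ i → c i * ι (v i j)) ≡ ι (x j))

AffinelyIndependent : ∀ {n d} → (Fin (suc d) → Point n) → Set
AffinelyIndependent {n} {d} v =
  ∀ (c : Fin (suc d) → ℚ) →
    Σℚ c ≡ 0ℚ →
    (∀ (j : Fin n) → Σℚ (λ i → c i * ι (v i j)) ≡ 0ℚ) →
    ∀ i → c i ≡ 0ℚ

EmptyLatticeSimplex : ∀ {n d} → (Fin (suc d) → Point n) → Set
EmptyLatticeSimplex {n} {d} v =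
  AffinelyIndependent v ×
  (∀ (x : Point n) → InScaled 1 v x → ∃ λ (i : Fin (suc d)) → ∀ j → v i j ≡ x j)

-- Write x ∈ nK in barycentric coordinates c, so x = Σ cᵢ vᵢ with cᵢ ≥ 0 and Σ cᵢ = n. If some
-- cᵢ ≥ 1, then z = vᵢ works. Otherwise every cᵢ < 1, so the simplex has d + 1 > n vertices;
-- affine independence gives d ≤ n, hence d = n. The lattice point w = Σ vᵢ − x then has
-- coordinates 1 − cᵢ ≥ 0 summing to (n + 1) − n = 1, so w ∈ K, and emptiness makes w a
-- vertex v_k. Uniqueness of barycentric coordinates forces 1 − cᵢ = δₖᵢ, so cᵢ = 1 for any
-- i ≠ k, a contradiction.
module Submission where

open import Defs
open import Data.Nat using (ℕ; suc; _≤_; _∸_)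
open import Data.Integer using (_-_)
open import Data.Fin using (Fin)
open import Data.Product using (Σ; _×_)

open import Algebra.Properties.Group as GroupProperties using ()
open import Data.Empty using (⊥-elim)
open import Data.Fin using (zero; suc; punchIn; punchOut)
open import Data.Fin.Properties using (all?; any?; ¬∀⟶∃¬; punchIn-punchOut)
  renaming (_≟_ to _≟ᶠ_)
open import Data.Integer as ℤ using (ℤ; +_)
import Data.Integer.Properties as ℤ
open import Data.Nat as ℕ using (zero; z≤n; s≤s)
import Data.Nat.Properties as ℕ
open import Data.Product using (∃; _,_; proj₁; proj₂)
open import Data.Rational
  using (ℚ; 0ℚ; 1ℚ; _+_; _*_; -_; 1/_; NonZero; ≢-nonZero; fromℚᵘ)
  renaming (_≤_ to _≤ℚ_; _<_ to _<ℚ_; _-_ to _-ℚ_)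
import Data.Rational.Properties as ℚ
open import Data.Rational.Solver using (module +-*-Solver)
open import Data.Rational.Unnormalised as ℚᵘ using (mkℚᵘ; *≡*)
import Data.Rational.Unnormalised.Properties as ℚᵘ
open import Relation.Binary.PropositionalEquality
open import Relation.Nullary using (¬_; yes; no)

open +-*-Solver
open GroupProperties ℚ.+-0-group using (x∙y⁻¹≈ε⇒x≈y)

-- ι a is by definition fromℚᵘ (mkℚᵘ a 0), so ι inherits the homomorphism properties of fromℚᵘ.

fromℚᵘ-homo-+ : ∀ p q → fromℚᵘ (p ℚᵘ.+ q) ≡ fromℚᵘ p + fromℚᵘ q
fromℚᵘ-homo-+ p q = ℚ.toℚᵘ-injective (ℚᵘ.≃-trans (ℚ.toℚᵘ-fromℚᵘ (p ℚᵘ.+ q))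
  (ℚᵘ.≃-sym (ℚᵘ.≃-trans (ℚ.toℚᵘ-homo-+ (fromℚᵘ p) (fromℚᵘ q))
    (ℚᵘ.+-cong (ℚ.toℚᵘ-fromℚᵘ p) (ℚ.toℚᵘ-fromℚᵘ q)))))

fromℚᵘ-homo‿- : ∀ p → fromℚᵘ (ℚᵘ.- p) ≡ - fromℚᵘ p
fromℚᵘ-homo‿- p = ℚ.toℚᵘ-injective (ℚᵘ.≃-trans (ℚ.toℚᵘ-fromℚᵘ (ℚᵘ.- p))
  (ℚᵘ.≃-sym (ℚᵘ.≃-trans (ℚ.toℚᵘ-homo‿- (fromℚᵘ p)) (ℚᵘ.-‿cong (ℚ.toℚᵘ-fromℚᵘ p)))))

ι-homo-+ : ∀ a b → ι (a ℤ.+ b) ≡ ι a + ι b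
ι-homo-+ a b = trans (ℚ.fromℚᵘ-cong {mkℚᵘ (a ℤ.+ b) 0} {mkℚᵘ a 0 ℚᵘ.+ mkℚᵘ b 0} (*≡* numerators))
  (fromℚᵘ-homo-+ (mkℚᵘ a 0) (mkℚᵘ b 0))
  where
  numerators : (a ℤ.+ b) ℤ.* + 1 ≡ (a ℤ.* + 1 ℤ.+ b ℤ.* + 1) ℤ.* + 1
  numerators = cong (ℤ._* + 1) (sym (cong₂ ℤ._+_ (ℤ.*-identityʳ a) (ℤ.*-identityʳ b)))

ι-homo‿- : ∀ a → ι (ℤ.- a) ≡ - ι a
ι-homo‿- a = fromℚᵘ-homo‿- (mkℚᵘ a 0)

ι-homo-- : ∀ a b → ι (a - b) ≡ ι a -ℚ ι b
ι-homo-- a b = trans (ι-homo-+ a (ℤ.- b)) (cong (λ t → ι a + t) (ι-homo‿- b))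

ι-suc : ∀ m → ι (+ suc m) ≡ 1ℚ + ι (+ m)
ι-suc m = ι-homo-+ (+ 1) (+ m)

ι-nonneg : ∀ m → 0ℚ ≤ℚ ι (+ m)
ι-nonneg m = ℚ.nonNegative⁻¹ (ι (+ m)) {{ℚ.normalize-nonNeg m 1}}

ι-mono-≤ : ∀ {m n} → m ≤ n → ι (+ m) ≤ℚ ι (+ n)
ι-mono-≤ {n = n} z≤n = ι-nonneg n
ι-mono-≤ {suc m} {suc n} (s≤s m≤n) rewrite ι-suc m | ι-suc n = ℚ.+-monoʳ-≤ 1ℚ (ι-mono-≤ m≤n)

Σℤ : ∀ {k} → (Fin k → ℤ) → ℤ
Σℤ {zero}  f = + 0
Σℤ {suc k} f = f zero ℤ.+ Σℤ (λ i → f (suc i))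

ι-homo-Σ : ∀ {k} (f : Fin k → ℤ) → ι (Σℤ f) ≡ Σℚ (λ i → ι (f i))
ι-homo-Σ {zero}  f = refl
ι-homo-Σ {suc k} f = trans (ι-homo-+ (f zero) (Σℤ (λ i → f (suc i))))
  (cong (λ t → ι (f zero) + t) (ι-homo-Σ (λ i → f (suc i))))

Σℚ-cong : ∀ {k} {f g : Fin k → ℚ} → (∀ i → f i ≡ g i) → Σℚ f ≡ Σℚ g
Σℚ-cong {zero}  f≗g = refl
Σℚ-cong {suc k} f≗g = cong₂ _+_ (f≗g zero) (Σℚ-cong (λ i → f≗g (suc i)))

Σℚ-sub : ∀ {k} (f g : Fin k → ℚ) → Σℚ (λ i → f i -ℚ g i) ≡ Σℚ f -ℚ Σℚ g
Σℚ-sub {zero}  f g = refl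
Σℚ-sub {suc k} f g rewrite Σℚ-sub (λ i → f (suc i)) (λ i → g (suc i)) =
  solve 4 (λ a b F G → (a :- b) :+ (F :- G) := (a :+ F) :- (b :+ G)) refl
    (f zero) (g zero) (Σℚ (λ i → f (suc i))) (Σℚ (λ i → g (suc i)))

Σℚ-*ˡ : ∀ {k} r (f : Fin k → ℚ) → Σℚ (λ i → r * f i) ≡ r * Σℚ f
Σℚ-*ˡ {zero}  r f = sym (ℚ.*-zeroʳ r)
Σℚ-*ˡ {suc k} r f = trans (cong (λ t → r * f zero + t) (Σℚ-*ˡ r (λ i → f (suc i))))
  (sym (ℚ.*-distribˡ-+ r (f zero) (Σℚ (λ i → f (suc i)))))

Σℚ-1 : ∀ k → Σℚ {k} (λ _ → 1ℚ) ≡ ι (+ k)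
Σℚ-1 zero    = refl
Σℚ-1 (suc k) = trans (cong (λ t → 1ℚ + t) (Σℚ-1 k)) (sym (ι-suc k))

Σℚ-mono-≤ : ∀ {k} {f g : Fin k → ℚ} → (∀ i → f i ≤ℚ g i) → Σℚ f ≤ℚ Σℚ g
Σℚ-mono-≤ {zero}  f≤g = ℚ.≤-refl
Σℚ-mono-≤ {suc k} f≤g = ℚ.+-mono-≤ (f≤g zero) (Σℚ-mono-≤ (λ i → f≤g (suc i)))

Σℚ-mono-< : ∀ {k} {f g : Fin (suc k) → ℚ} → (∀ i → f i <ℚ g i) → Σℚ f <ℚ Σℚ g
Σℚ-mono-< f<g = ℚ.+-mono-<-≤ (f<g zero) (Σℚ-mono-≤ (λ i → ℚ.<⇒≤ (f<g (suc i))))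

p≤q⇒0≤q-p : ∀ {p q} → p ≤ℚ q → 0ℚ ≤ℚ q -ℚ p
p≤q⇒0≤q-p {p} {q} p≤q = subst (_≤ℚ q -ℚ p) (ℚ.+-inverseʳ p) (ℚ.+-monoˡ-≤ (- p) p≤q)

dot : ∀ {k} → (Fin k → ℚ) → (Fin k → ℚ) → ℚ
dot c a = Σℚ (λ i → c i * a i)

dot-1ˡ : ∀ {k} (a : Fin k → ℚ) → dot (λ _ → 1ℚ) a ≡ Σℚ a
dot-1ˡ a = Σℚ-cong (λ i → ℚ.*-identityˡ (a i))

dot-1ʳ : ∀ {k} (c : Fin k → ℚ) → dot c (λ _ → 1ℚ) ≡ Σℚ c
dot-1ʳ c = Σℚ-cong (λ i → ℚ.*-identityʳ (c i))

dot-subˡ : ∀ {k} (b c a : Fin k → ℚ) → dot (λ i → b i -ℚ c i) a ≡ dot b a -ℚ dot c a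
dot-subˡ b c a = trans
  (Σℚ-cong (λ i → solve 3 (λ b c a → (b :- c) :* a := b :* a :- c :* a) refl (b i) (c i) (a i)))
  (Σℚ-sub (λ i → b i * a i) (λ i → c i * a i))

dot-sub-scaledʳ : ∀ {k} (c a b : Fin k → ℚ) r →
  dot c (λ i → a i -ℚ r * b i) ≡ dot c a -ℚ r * dot c b
dot-sub-scaledʳ c a b r = begin
  dot c (λ i → a i -ℚ r * b i)
    ≡⟨ Σℚ-cong (λ i → solve 4 (λ c a b r → c :* (a :- r :* b) := c :* a :- r :* (c :* b)) refl
         (c i) (a i) (b i) r) ⟩
  Σℚ (λ i → c i * a i -ℚ r * (c i * b i))
    ≡⟨ Σℚ-sub (λ i → c i * a i) (λ i → r * (c i * b i)) ⟩
  dot c a -ℚ Σℚ (λ i → r * (c i * b i))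
    ≡⟨ cong (dot c a -ℚ_) (Σℚ-*ˡ r (λ i → c i * b i)) ⟩
  dot c a -ℚ r * dot c b ∎
  where open ≡-Reasoning

δ : ∀ {k} → Fin k → Fin k → ℚ
δ zero    zero    = 1ℚ
δ zero    (suc _) = 0ℚ
δ (suc _) zero    = 0ℚ
δ (suc i) (suc j) = δ i j

dot-δˡ : ∀ {k} (i : Fin k) (a : Fin k → ℚ) → dot (δ i) a ≡ a i
dot-δˡ {suc k} zero a = begin
  1ℚ * a zero + Σℚ (λ j → 0ℚ * tail j) ≡⟨ cong₂ _+_ (ℚ.*-identityˡ (a zero)) (Σℚ-*ˡ 0ℚ tail) ⟩
  a zero + 0ℚ * Σℚ tail                ≡⟨ cong (λ t → a zero + t) (ℚ.*-zeroˡ (Σℚ tail)) ⟩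
  a zero + 0ℚ                          ≡⟨ ℚ.+-identityʳ (a zero) ⟩
  a zero                               ∎
  where
  open ≡-Reasoning
  tail = λ j → a (suc j)
dot-δˡ {suc k} (suc i) a = trans (cong (_+ dot (δ i) (λ j → a (suc j))) (ℚ.*-zeroˡ (a zero)))
  (trans (ℚ.+-identityˡ _) (dot-δˡ i (λ j → a (suc j))))

Σℚ-δ : ∀ {k} (i : Fin k) → Σℚ (δ i) ≡ 1ℚ
Σℚ-δ i = trans (sym (dot-1ʳ (δ i))) (dot-δˡ i (λ _ → 1ℚ))

δ-nonneg : ∀ {k} (i j : Fin k) → 0ℚ ≤ℚ δ i j
δ-nonneg zero    zero    = ι-nonneg 1
δ-nonneg zero    (suc j) = ℚ.≤-refl
δ-nonneg (suc i) zero    = ℚ.≤-refl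
δ-nonneg (suc i) (suc j) = δ-nonneg i j

δ≤ : ∀ {k} {c : Fin k → ℚ} (i : Fin k) → (∀ j → 0ℚ ≤ℚ c j) → 1ℚ ≤ℚ c i → ∀ j → δ i j ≤ℚ c j
δ≤ zero    c≥0 c₀≥1 zero    = c₀≥1
δ≤ zero    c≥0 _    (suc j) = c≥0 (suc j)
δ≤ (suc i) c≥0 _    zero    = c≥0 zero
δ≤ (suc i) c≥0 cᵢ≥1 (suc j) = δ≤ i (λ j → c≥0 (suc j)) cᵢ≥1 j

∃-δ≡0 : ∀ {k} (i : Fin (suc (suc k))) → ∃ λ j → δ i j ≡ 0ℚ
∃-δ≡0 zero    = suc zero , refl
∃-δ≡0 (suc i) = zero , refl

-- Homogeneous linear systems with more unknowns than equations

module Elimination {k} (a : Fin (suc k) → ℚ) .{{a₀≢0 : NonZero (a zero)}} where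

  reduce : (Fin (suc k) → ℚ) → Fin k → ℚ
  reduce b i = b (suc i) -ℚ (b zero * 1/ a zero) * a (suc i)

  -- The first unknown is solved for from the pivot equation a.
  lift : (Fin k → ℚ) → Fin (suc k) → ℚ
  lift c zero    = - (dot c (λ i → a (suc i)) * 1/ a zero)
  lift c (suc i) = c i

  dot-lift : ∀ c b →
    dot (lift c) b ≡ dot c (λ i → b (suc i)) -ℚ (b zero * 1/ a zero) * dot c (λ i → a (suc i))
  dot-lift c b = solve 4 (λ S q b₀ T → (:- (S :* q)) :* b₀ :+ T := T :- (b₀ :* q) :* S) refl
    (dot c (λ i → a (suc i))) (1/ a zero) (b zero) (dot c (λ i → b (suc i)))

  dot-lift-reduce : ∀ c b → dot (lift c) b ≡ dot c (reduce b)
  dot-lift-reduce c b = trans (dot-lift c b)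
    (sym (dot-sub-scaledʳ c (λ i → b (suc i)) (λ i → a (suc i)) (b zero * 1/ a zero)))

  dot-lift-pivot : ∀ c → dot (lift c) a ≡ 0ℚ
  dot-lift-pivot c = begin
    dot (lift c) a            ≡⟨ dot-lift c a ⟩
    S -ℚ (a zero * 1/ a zero) * S ≡⟨ cong (λ t → S -ℚ t * S) (ℚ.*-inverseʳ (a zero)) ⟩
    S -ℚ 1ℚ * S                ≡⟨ solve 1 (λ S → S :- con 1ℚ :* S := con 0ℚ) refl S ⟩
    0ℚ                        ∎
    where
    open ≡-Reasoning
    S = dot c (λ i → a (suc i))

kernel-nontrivial : ∀ {m k} (A : Fin m → Fin k → ℚ) → m ℕ.< k →
  ∃ λ c → (∀ r → dot c (A r) ≡ 0ℚ) × ∃ λ i → ¬ c i ≡ 0ℚ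
kernel-nontrivial {zero}  {suc k} A _ = δ zero , (λ ()) , zero , ℚ.1≢0
kernel-nontrivial {suc m} {suc k} A (s≤s m<k) with all? (λ r → A r zero ℚ.≟ 0ℚ)
... | yes column₀≡0 = δ zero , (λ r → trans (dot-δˡ zero (A r)) (column₀≡0 r)) , zero , ℚ.1≢0
... | no ¬column₀≡0 =
  let (c , c-solves , i , cᵢ≢0) = kernel-nontrivial reduced m<k
  in lift c , lift-solves c c-solves , suc i , cᵢ≢0
  where
  pivot = ¬∀⟶∃¬ _ _ (λ r → A r zero ℚ.≟ 0ℚ) ¬column₀≡0
  p = proj₁ pivot
  open Elimination (A p) {{≢-nonZero (proj₂ pivot)}}
  reduced : Fin m → Fin k → ℚ
  reduced r = reduce (A (punchIn p r))
  lift-solves : ∀ c → (∀ r → dot c (reduced r) ≡ 0ℚ) → ∀ r → dot (lift c) (A r) ≡ 0ℚ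
  lift-solves c c-solves r with p ≟ᶠ r
  ... | yes refl = dot-lift-pivot c
  ... | no p≢r = subst (λ r → dot (lift c) (A r) ≡ 0ℚ) (punchIn-punchOut p≢r)
    (trans (dot-lift-reduce c (A (punchIn p (punchOut p≢r)))) (c-solves (punchOut p≢r)))

module _ {n d : ℕ} (v : Fin (suc d) → Point n) where

  coordinates : Fin n → Fin (suc d) → ℚ
  coordinates j i = ι (v i j)

  -- The data of InScaled m v x with its coefficient vector c exposed, as a record so that
  -- v, m, x and c can be inferred from a proof.
  record Barycentric (m : ℕ) (x : Point n) (c : Fin (suc d) → ℚ) : Set where
    constructor barycentric
    field
      nonneg     : ∀ i → 0ℚ ≤ℚ c i
      sum        : Σℚ c ≡ ι (+ m)
      represents : ∀ j → dot c (coordinates j) ≡ ι (x j)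

  Barycentric-cong : ∀ {m x y c} → (∀ j → x j ≡ y j) → Barycentric m x c → Barycentric m y c
  Barycentric-cong x≗y (barycentric c≥0 Σc≡m c-represents-x) =
    barycentric c≥0 Σc≡m (λ j → trans (c-represents-x j) (cong ι (x≗y j)))

  Barycentric⇒InScaled : ∀ {m x c} → Barycentric m x c → InScaled m v x
  Barycentric⇒InScaled {c = c} (barycentric c≥0 Σc≡m c-represents-x) =
    c , c≥0 , Σc≡m , c-represents-x

  affinelyIndependent⇒d≤n : AffinelyIndependent v → d ≤ n
  affinelyIndependent⇒d≤n independent = ℕ.≮⇒≥ λ n<d →
    let (c , c-solves , i , cᵢ≢0) = kernel-nontrivial equations (s≤s n<d)
    in cᵢ≢0 (independent c (trans (sym (dot-1ʳ c)) (c-solves zero)) (λ j → c-solves (suc j)) i)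
    where
    equations : Fin (suc n) → Fin (suc d) → ℚ
    equations zero    = λ _ → 1ℚ
    equations (suc j) = coordinates j

  barycentric-unique : AffinelyIndependent v → ∀ {m x a b} →
    Barycentric m x a → Barycentric m x b → ∀ i → a i ≡ b i
  barycentric-unique independent {m} {x} {a} {b}
    (barycentric _ Σa≡m a-represents-x) (barycentric _ Σb≡m b-represents-x) i =
    x∙y⁻¹≈ε⇒x≈y (a i) (b i) (independent (λ i → a i -ℚ b i) sums-agree coordinates-agree i)
    where
    sums-agree : Σℚ (λ i → a i -ℚ b i) ≡ 0ℚ
    sums-agree = trans (Σℚ-sub a b) (trans (cong₂ _-ℚ_ Σa≡m Σb≡m) (ℚ.+-inverseʳ (ι (+ m))))
    coordinates-agree : ∀ j → dot (λ i → a i -ℚ b i) (coordinates j) ≡ 0ℚ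
    coordinates-agree j = trans (dot-subˡ a b (coordinates j))
      (trans (cong₂ _-ℚ_ (a-represents-x j) (b-represents-x j)) (ℚ.+-inverseʳ (ι (x j))))

  vertex-barycentric : ∀ i → Barycentric 1 (v i) (δ i)
  vertex-barycentric i = barycentric (δ-nonneg i) (Σℚ-δ i) (λ j → dot-δˡ i (coordinates j))

  Barycentric-remove-vertex : ∀ {m x c} i → Barycentric (suc m) x c → 1ℚ ≤ℚ c i →
    Barycentric m (λ j → x j - v i j) (λ k → c k -ℚ δ i k)
  Barycentric-remove-vertex {m} {x} {c} i (barycentric c≥0 Σc≡1+m c-represents-x) cᵢ≥1 =
    barycentric (λ k → p≤q⇒0≤q-p (δ≤ i c≥0 cᵢ≥1 k)) sum coordinate
    where
    sum : Σℚ (λ k → c k -ℚ δ i k) ≡ ι (+ m)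
    sum = begin
      Σℚ (λ k → c k -ℚ δ i k) ≡⟨ Σℚ-sub c (δ i) ⟩
      Σℚ c -ℚ Σℚ (δ i)        ≡⟨ cong₂ _-ℚ_ (trans Σc≡1+m (ι-suc m)) (Σℚ-δ i) ⟩
      (1ℚ + ι (+ m)) -ℚ 1ℚ    ≡⟨ solve 1 (λ X → (con 1ℚ :+ X) :- con 1ℚ := X) refl (ι (+ m)) ⟩
      ι (+ m)                 ∎
      where open ≡-Reasoning
    coordinate : ∀ j → dot (λ k → c k -ℚ δ i k) (coordinates j) ≡ ι (x j - v i j)
    coordinate j = begin
      dot (λ k → c k -ℚ δ i k) (coordinates j)           ≡⟨ dot-subˡ c (δ i) (coordinates j) ⟩
      dot c (coordinates j) -ℚ dot (δ i) (coordinates j)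
        ≡⟨ cong₂ _-ℚ_ (c-represents-x j) (dot-δˡ i (coordinates j)) ⟩
      ι (x j) -ℚ ι (v i j)                               ≡⟨ ι-homo-- (x j) (v i j) ⟨
      ι (x j - v i j)                                    ∎
      where open ≡-Reasoning

  Barycentric-complement : ∀ {x c} → Barycentric d x c → (∀ i → c i ≤ℚ 1ℚ) →
    Barycentric 1 (λ j → Σℤ (λ i → v i j) - x j) (λ i → 1ℚ -ℚ c i)
  Barycentric-complement {x} {c} (barycentric _ Σc≡d c-represents-x) c≤1 =
    barycentric (λ i → p≤q⇒0≤q-p (c≤1 i)) sum coordinate
    where
    sum : Σℚ (λ i → 1ℚ -ℚ c i) ≡ 1ℚ
    sum = begin
      Σℚ (λ i → 1ℚ -ℚ c i)           ≡⟨ Σℚ-sub (λ _ → 1ℚ) c ⟩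
      Σℚ {suc d} (λ _ → 1ℚ) -ℚ Σℚ c ≡⟨ cong₂ _-ℚ_ (trans (Σℚ-1 (suc d)) (ι-suc d)) Σc≡d ⟩
      (1ℚ + ι (+ d)) -ℚ ι (+ d)      ≡⟨ solve 1 (λ X → (con 1ℚ :+ X) :- X := con 1ℚ) refl (ι (+ d)) ⟩
      1ℚ                             ∎
      where open ≡-Reasoning
    coordinate : ∀ j → dot (λ i → 1ℚ -ℚ c i) (coordinates j) ≡ ι (Σℤ (λ i → v i j) - x j)
    coordinate j = begin
      dot (λ i → 1ℚ -ℚ c i) (coordinates j)                 ≡⟨ dot-subˡ (λ _ → 1ℚ) c (coordinates j) ⟩
      dot (λ _ → 1ℚ) (coordinates j) -ℚ dot c (coordinates j)
        ≡⟨ cong₂ _-ℚ_ (trans (dot-1ˡ (coordinates j)) (sym (ι-homo-Σ (λ i → v i j)))) (c-represents-x j) ⟩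
      ι (Σℤ (λ i → v i j)) -ℚ ι (x j)                       ≡⟨ ι-homo-- (Σℤ (λ i → v i j)) (x j) ⟨
      ι (Σℤ (λ i → v i j) - x j)                            ∎
      where open ≡-Reasoning

  Barycentric-<1⇒m≤d : ∀ {m x c} → Barycentric m x c → (∀ i → c i <ℚ 1ℚ) → m ≤ d
  Barycentric-<1⇒m≤d {m} {c = c} (barycentric _ Σc≡m _) c<1 =
    ℕ.≮⇒≥ λ d<m → ℚ.<-irrefl Σc≡m (begin-strict
    Σℚ c                  <⟨ Σℚ-mono-< c<1 ⟩
    Σℚ {suc d} (λ _ → 1ℚ) ≡⟨ Σℚ-1 (suc d) ⟩
    ι (+ suc d)           ≤⟨ ι-mono-≤ d<m ⟩
    ι (+ m)               ∎)
    where open ℚ.≤-Reasoning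

module _ {n e : ℕ} (v : Fin (suc (suc e)) → Point n) where

  emptySimplex⇒¬Barycentric-<1 : EmptyLatticeSimplex v → ∀ {x c} → Barycentric v (suc e) x c →
    ¬ (∀ i → c i <ℚ 1ℚ)
  emptySimplex⇒¬Barycentric-<1 (independent , empty) {x} {c} x∈dK c<1 =
    ℚ.<-irrefl (sym 1≡cₒ) (c<1 o)
    where
    w : Point n
    w j = Σℤ (λ i → v i j) - x j
    w∈K : Barycentric v 1 w (λ i → 1ℚ -ℚ c i)
    w∈K = Barycentric-complement v x∈dK (λ i → ℚ.<⇒≤ (c<1 i))
    w-is-vertex = empty w (Barycentric⇒InScaled v w∈K)
    k = proj₁ w-is-vertex
    vₖ∈K : Barycentric v 1 w (δ k)
    vₖ∈K = Barycentric-cong v (proj₂ w-is-vertex) (vertex-barycentric v k)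
    o = proj₁ (∃-δ≡0 k)
    1≡cₒ : 1ℚ ≡ c o
    1≡cₒ = x∙y⁻¹≈ε⇒x≈y 1ℚ (c o)
      (trans (barycentric-unique v independent w∈K vₖ∈K o) (proj₂ (∃-δ≡0 k)))

module _ {n d : ℕ} (v : Fin (suc d) → Point (suc n)) where

  emptySimplex⇒Barycentric-≥1 : EmptyLatticeSimplex v → ∀ {x c} → Barycentric v (suc n) x c →
    ∃ λ i → 1ℚ ≤ℚ c i
  emptySimplex⇒Barycentric-≥1 (independent , empty) {x} {c} x∈nK with any? (λ i → 1ℚ ℚ.≤? c i)
  ... | yes large = large
  ... | no ¬large =
    ⊥-elim (n+1≢d (ℕ.≤-antisym (Barycentric-<1⇒m≤d v x∈nK c<1)
                               (affinelyIndependent⇒d≤n v independent)))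
    where
    c<1 : ∀ i → c i <ℚ 1ℚ
    c<1 i = ℚ.≰⇒> (λ 1≤cᵢ → ¬large (i , 1≤cᵢ))
    n+1≢d : ¬ suc n ≡ d
    n+1≢d refl = emptySimplex⇒¬Barycentric-<1 v (independent , empty) x∈nK c<1

lemma2 : (n : ℕ) → 2 ≤ n → (d : ℕ) → (v : Fin (suc d) → Point n) →
    EmptyLatticeSimplex v →
    (x : Point n) → InScaled n v x →
    Σ (Point n) λ z → InScaled 1 v z × InScaled (n ∸ 1) v (λ j → x j - z j)
lemma2 (suc n) _ d v empty x (c , c≥0 , Σc≡n , c-represents-x) =
  v i , Barycentric⇒InScaled v (vertex-barycentric v i) ,
  Barycentric⇒InScaled v (Barycentric-remove-vertex v i x∈nK 1≤cᵢ)
  where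
  x∈nK : Barycentric v (suc n) x c
  x∈nK = barycentric c≥0 Σc≡n c-represents-x
  large = emptySimplex⇒Barycentric-≥1 v empty x∈nK
  i = proj₁ large
  1≤cᵢ = proj₂ large
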